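{- $1\mathrm{SP}\nsubseteq 1\mathrm{N}$.
   Context: A one-way nondeterministic finite automaton (1nfa) is $M=(Q,\Sigma,\{\rhd,\lhd\},\delta,q_0,Q_{acc},Q_{rej})$: finite state set $Q$, input alphabet $\Sigma$, endmarkers $\rhd,\lhd\notin\Sigma$, disjoint sets $Q_{acc},Q_{rej}\subseteq Q$ ($Q_{halt}=Q_{acc}\cup Q_{rej}$), transition function $\delta:(Q-Q_{halt})\times(\Sigma\cup\{\rhd,\lhd\})\to\mathcal P(Q)$. On input $x$ it reads $\rhd x\lhd$ left to right, moving its head one cell right at every step (no $\lambda$-moves), halting on entering a halting state. A path is accepting (resp. rejecting) if it enters $Q_{acc}$ (resp. $Q_{rej}$), otherwise neither. $\#M(x)$, $\#\overline{M}(x)$ are the numbers of accepting and rejecting paths on $x$. A family $\{M_n\}_{n\in\mathbb N}$ has polynomial size if $|Q_n|\le p(n)$ for a fixed polynomial $p$. A family of promise problems over a fixed alphabet $\Sigma$ is $\mathcal L=\{(L_n^{(+)},L_n^{(-)})\}_{n\in\mathbb N}$ with $L_n^{(+)},L_n^{(-)}\subseteq\Sigma^*$ disjoint. A family of partial functions is $\{(f_n,D_n)\}_n$, $D_n\subseteq\Sigma^*$. $1\#$ (resp. $1\mathrm{Gap}$) is the class of such families for which a polynomial-size family of 1nfa's satisfies $f_n(x)=\#M_n(x)$ (resp. $f_n(x)=\#M_n(x)-\#\overline{M}_n(x)$) for all $n$, $x\in D_n$. $\mathcal L\in1\mathrm N$ iff some $\{(f_n,D_n)\}\in1\#$ has $L_n^{(+)}\cup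 L_n^{(-)}\subseteq D_n$, $f_n>0$ on $L_n^{(+)}$, $f_n=0$ on $L_n^{(-)}$ for all $n$. $\mathcal L\in1\mathrm{SP}$ iff some $\{(f_n,D_n)\}\in1\mathrm{Gap}$ has $L_n^{(+)}\cup L_n^{(-)}\subseteq D_n$, $f_n=1$ on $L_n^{(+)}$, $f_n=0$ on $L_n^{(-)}$ for all $n$. -}

module Defs where

open import Data.Nat using (ℕ; zero; suc; _+_; _*_; _≤_; _>_)
open import Data.Integer using (ℤ; +_; _-_)
open import Data.Fin using (Fin)
open import Data.Bool using (Bool; true; false; if_then_else_; T)
open import Data.List using (List; []; _∷_; map; allFin; _++_; [_])
open import Data.Nat.ListAction using (sum)
open import Data.Product using (Σ; ∃; _×_; _,_)
open import Data.Sum using (_⊎_)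
open import Data.Empty using (⊥)
open import Relation.Nullary using (¬_)
open import Relation.Binary.PropositionalEquality using (_≡_)

data Tape (k : ℕ) : Set where
  sym  : Fin k → Tape k
  lend : Tape k
  rend : Tape k

tape : ∀ {k} → List (Fin k) → List (Tape k)
tape x = lend ∷ map sym x ++ [ rend ]

sumFin : (m : ℕ) → (Fin m → ℕ) → ℕ
sumFin m f = sum (map f (allFin m))

-- Values of δ on
-- halting states are irrelevant (never used).
record NFA (k m : ℕ) : Set where
  field
    δ     : Fin m → Tape k → Fin m → Bool
    q₀    : Fin m
    acc   : Fin m → Bool
    rej   : Fin m → Bool
    disj  : ∀ q → T (acc q) → T (rej q) → ⊥

-- The head moves right at every step; a path that falls off the tape after ◁
-- without having halted is neither accepting nor rejecting.
module _ {k m : ℕ} (M : NFA k m) (goal : Fin m → Bool) where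
  open NFA M
  count : Fin m → List (Tape k) → ℕ
  count q w with goal q | acc q | rej q
  ... | true  | _     | _     = 1
  ... | false | true  | _     = 0
  ... | false | false | true  = 0
  ... | false | false | false with w
  ...   | []      = 0
  ...   | a ∷ w'  = sumFin m (λ q' → if δ q a q' then count q' w' else 0)

#acc : ∀ {k m} → NFA k m → List (Fin k) → ℕ
#acc M x = count M (NFA.acc M) (NFA.q₀ M) (tape x)

#rej : ∀ {k m} → NFA k m → List (Fin k) → ℕ
#rej M x = count M (NFA.rej M) (NFA.q₀ M) (tape x)

evalPoly : List ℕ → ℕ → ℕ
evalPoly []       n = 0
evalPoly (c ∷ cs) n = c + n * evalPoly cs n

record PolyNFAFamily (k : ℕ) : Set where
  field
    size  : ℕ → ℕ
    M     : (n : ℕ) → NFA k (size n)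
    poly  : List ℕ
    bound : ∀ n → size n ≤ evalPoly poly n

record PromiseFamily (k : ℕ) : Set₁ where
  field
    L+   : ℕ → List (Fin k) → Set
    L-   : ℕ → List (Fin k) → Set
    disj : ∀ n x → L+ n x → L- n x → ⊥

-- Families of partial functions {(f_n, D_n)}: f_n is given totally, only its values on D_n matter.
In1Sharp : ∀ {k} → (ℕ → List (Fin k) → ℕ) → (ℕ → List (Fin k) → Set) → Set
In1Sharp {k} f D = Σ (PolyNFAFamily k) λ F →
  ∀ n x → D n x → f n x ≡ #acc (PolyNFAFamily.M F n) x

In1Gap : ∀ {k} → (ℕ → List (Fin k) → ℤ) → (ℕ → List (Fin k) → Set) → Set
In1Gap {k} f D = Σ (PolyNFAFamily k) λ F →
  ∀ n x → D n x → f n x ≡ (+ #acc (PolyNFAFamily.M F n) x) - (+ #rej (PolyNFAFamily.M F n) x)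

In1N : ∀ {k} → PromiseFamily k → Set₁
In1N {k} L = Σ (ℕ → List (Fin k) → ℕ) λ f → Σ (ℕ → List (Fin k) → Set) λ D →
  In1Sharp f D ×
  (∀ n x → (L+ n x ⊎ L- n x) → D n x) ×
  (∀ n x → L+ n x → f n x > 0) ×
  (∀ n x → L- n x → f n x ≡ 0)
  where open PromiseFamily L

In1SP : ∀ {k} → PromiseFamily k → Set₁
In1SP {k} L = Σ (ℕ → List (Fin k) → ℤ) λ f → Σ (ℕ → List (Fin k) → Set) λ D →
  In1Gap f D ×
  (∀ n x → (L+ n x ⊎ L- n x) → D n x) ×
  (∀ n x → L+ n x → f n x ≡ + 1) ×
  (∀ n x → L- n x → f n x ≡ + 0)
  where open PromiseFamily L

-- The separating promise problems live on the words bᴰ aᵐ, where D grows slowly with the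
-- index n and the moduli dᵣ = 1 + (r + 1)·(D + 3)! (r < D) are pairwise coprime: yes-instances
-- have every dᵣ dividing m, no-instances have exactly one dᵣ not dividing m.
--
-- Membership in 1SP: a 1nfa accepts along exactly one path and, for each r, has one rejecting
-- path that guesses r while reading the b's and counts the a's modulo dᵣ, rejecting iff the
-- residue is nonzero.  Its gap 1 − #{r | dᵣ ∤ m} is 1 on yes- and 0 on no-instances, and its
-- size (D + 1)·((D + 3)!)² is polynomial in n by the choice of D.
--
-- Non-membership in 1N: a 1nfa with s < ∏ dᵣ states that accepts the yes-instance m = s·∏ dᵣ
-- can, by pumping the block of a's, also accept m + t·ℓ for every t and some 1 ≤ ℓ ≤ s.  Some
-- d_{r₀} does not divide ℓ (else ∏ dᵣ ∣ ℓ), and t = ∏_{r ≠ r₀} dᵣ then gives an accepted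
-- no-instance.  As ∏ dᵣ ≥ ((D + 3)!)ᴰ outgrows every polynomial in the size of the gap
-- automaton, every polynomial-size family has a member with s < ∏ dᵣ.
module Submission where

open import Defs
open import Algebra.Properties.CommutativeSemigroup using (interchange)
open import Data.Bool using (Bool; true; false; if_then_else_; T; _∨_)
open import Data.Bool.ListAction using (any)
open import Data.Empty using (⊥; ⊥-elim)
open import Data.Fin using (Fin; zero; suc; toℕ; fromℕ<)
open import Data.Fin.Properties using (pigeonhole; toℕ<n; toℕ-fromℕ<)
open import Data.Integer using (ℤ; _-_)
import Data.Integer as ℤ
open import Data.List
  using (List; []; _∷_; [_]; _++_; map; allFin; filter; replicate; length; applyDownFrom; downFrom)
open import Data.List.Membership.Propositional using (_∈_)
open import Data.List.Membership.Propositional.Properties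
  using (∈-map⁺; ∈-filter⁺; ∈-filter⁻; ∈-downFrom⁺; ∈-downFrom⁻; ∈-applyDownFrom⁺)
open import Data.List.Properties
  using ( map-tabulate; map-cong; map-∘; map-cong-local; map-++; map-replicate; ++-assoc
        ; length-++; length-replicate; length-applyDownFrom)
open import Data.List.Relation.Unary.All using (All; []; _∷_; all?)
import Data.List.Relation.Unary.All as All
import Data.List.Relation.Unary.All.Properties as All
open import Data.List.Relation.Unary.AllPairs using (AllPairs; []; _∷_)
import Data.List.Relation.Unary.AllPairs.Properties as AllPairs
import Data.List.Relation.Unary.Any.Properties as Any
open import Data.List.Relation.Unary.Unique.Propositional using (Unique)
open import Data.Nat
  using ( ℕ; zero; suc; _+_; _*_; _∸_; _^_; _≤_; _<_; _>_; z≤n; s≤s; _!; _/_; _%_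
        ; _≡ᵇ_; _≟_; _≤?_; _<?_; NonZero; >-nonZero)
open import Data.Nat.Properties
open import Data.Nat.DivMod
open import Data.Nat.Divisibility
open import Data.Nat.Coprimality using (Coprime; coprime-divisor)
import Data.Nat.Coprimality as Coprime
open import Data.Nat.ListAction using (sum; product)
open import Data.Nat.ListAction.Properties using (∈⇒∣product)
open import Data.Nat.Tactic.RingSolver using (solve-∀)
open import Data.Product using (Σ; ∃; _×_; _,_; proj₁; proj₂)
open import Data.Sum using (_⊎_; inj₁; inj₂)
open import Function using (_∘_)
open import Relation.Binary using (tri<; tri≈; tri>)
open import Relation.Binary.PropositionalEquality hiding (sym; [_])
import Relation.Binary.PropositionalEquality as ≡
open import Relation.Nullary using (¬_; yes; no; ¬?)

_∈ᵇ_ : ℕ → List ℕ → Bool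
v ∈ᵇ vs = any (v ≡ᵇ_) vs

∉⇒¬∈ᵇ : ∀ {v vs} → All (v ≢_) vs → ¬ T (v ∈ᵇ vs)
∉⇒¬∈ᵇ {v} {u ∷ us} (v≢u ∷ v∉us) v∈ᵇ with v ≡ᵇ u in v≡ᵇu
... | true  = v≢u (≡ᵇ⇒≡ v u (subst T (≡.sym v≡ᵇu) _))
... | false = ∉⇒¬∈ᵇ v∉us v∈ᵇ

sum-map-+ : ∀ {A : Set} (f g : A → ℕ) xs →
  sum (map (λ x → f x + g x) xs) ≡ sum (map f xs) + sum (map g xs)
sum-map-+ f g []       = refl
sum-map-+ f g (x ∷ xs) = trans (cong ((f x + g x) +_) (sum-map-+ f g xs))
  (interchange +-commutativeSemigroup (f x) (g x) _ _)

sumFin-suc : ∀ n (f : Fin (suc n) → ℕ) → sumFin (suc n) f ≡ f zero + sumFin n (f ∘ suc)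
sumFin-suc n f = cong (λ xs → f zero + sum xs)
  (trans (map-tabulate suc f) (≡.sym (map-tabulate (λ i → i) (f ∘ suc))))

sumFin-cong : ∀ n {f g : Fin n → ℕ} → (∀ i → f i ≡ g i) → sumFin n f ≡ sumFin n g
sumFin-cong n f≗g = cong sum (map-cong f≗g (allFin n))

sumFin-zero : ∀ n (f : Fin n → ℕ) → (∀ i → f i ≡ 0) → sumFin n f ≡ 0
sumFin-zero zero    f f≗0 = refl
sumFin-zero (suc n) f f≗0 rewrite sumFin-suc n f | f≗0 zero = sumFin-zero n (f ∘ suc) (f≗0 ∘ suc)

sumFin-+ : ∀ n (f g : Fin n → ℕ) → sumFin n (λ i → f i + g i) ≡ sumFin n f + sumFin n g
sumFin-+ n f g = sum-map-+ f g (allFin n)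

≤sumFin : ∀ n (f : Fin n → ℕ) i → f i ≤ sumFin n f
≤sumFin (suc n) f zero    rewrite sumFin-suc n f = m≤m+n _ _
≤sumFin (suc n) f (suc i) rewrite sumFin-suc n f = ≤-trans (≤sumFin n (f ∘ suc) i) (m≤n+m _ _)

sumFin-positive : ∀ n (f : Fin n → ℕ) → sumFin n f > 0 → ∃ λ i → f i > 0
sumFin-positive (suc n) f pos rewrite sumFin-suc n f with f zero in f0≡
... | suc _ = zero , subst (_> 0) (≡.sym f0≡) (s≤s z≤n)
... | zero with i , fi>0 ← sumFin-positive n (f ∘ suc) pos = suc i , fi>0

sumFin-singleton : ∀ n v (g : ℕ → ℕ) → v < n →
  sumFin n (λ i → if toℕ i ≡ᵇ v then g (toℕ i) else 0) ≡ g v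
sumFin-singleton (suc n) zero g _
  rewrite sumFin-suc n (λ i → if toℕ i ≡ᵇ 0 then g (toℕ i) else 0) =
  trans (cong (g 0 +_) (sumFin-zero n _ (λ _ → refl))) (+-identityʳ (g 0))
sumFin-singleton (suc n) (suc v) g (s≤s v<n)
  rewrite sumFin-suc n (λ i → if toℕ i ≡ᵇ suc v then g (toℕ i) else 0) =
  sumFin-singleton n v (g ∘ suc) v<n

sumFin-indicator : ∀ n vs (g : ℕ → ℕ) → Unique vs → All (_< n) vs →
  sumFin n (λ i → if toℕ i ∈ᵇ vs then g (toℕ i) else 0) ≡ sum (map g vs)
sumFin-indicator n []       g _ _ = sumFin-zero n _ (λ _ → refl)
sumFin-indicator n (v ∷ vs) g (v∉vs ∷ vs-unique) (v<n ∷ vs<n) = begin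
  sumFin n (λ i → if (toℕ i ≡ᵇ v) ∨ (toℕ i ∈ᵇ vs) then g (toℕ i) else 0)
    ≡⟨ sumFin-cong n (λ i → split (toℕ i)) ⟩
  sumFin n (λ i → (if toℕ i ≡ᵇ v then g (toℕ i) else 0) + (if toℕ i ∈ᵇ vs then g (toℕ i) else 0))
    ≡⟨ sumFin-+ n _ _ ⟩
  sumFin n (λ i → if toℕ i ≡ᵇ v then g (toℕ i) else 0)
    + sumFin n (λ i → if toℕ i ∈ᵇ vs then g (toℕ i) else 0)
    ≡⟨ cong₂ _+_ (sumFin-singleton n v g v<n) (sumFin-indicator n vs g vs-unique vs<n) ⟩
  g v + sum (map g vs) ∎
  where
  open ≡-Reasoning
  split : ∀ u → (if (u ≡ᵇ v) ∨ (u ∈ᵇ vs) then g u else 0)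
              ≡ (if u ≡ᵇ v then g u else 0) + (if u ∈ᵇ vs then g u else 0)
  split u with u ≡ᵇ v in u≡ᵇv | u ∈ᵇ vs in u∈ᵇvs
  ... | true  | true  with refl ← ≡ᵇ⇒≡ u v (subst T (≡.sym u≡ᵇv) _) =
    ⊥-elim (∉⇒¬∈ᵇ v∉vs (subst T (≡.sym u∈ᵇvs) _))
  ... | true  | false = ≡.sym (+-identityʳ (g u))
  ... | false | _     = refl

sum-applyDownFrom-zero : ∀ f k → (∀ r → r < k → f r ≡ 0) → sum (applyDownFrom f k) ≡ 0
sum-applyDownFrom-zero f zero    _    = refl
sum-applyDownFrom-zero f (suc k) f≡0 =
  cong₂ _+_ (f≡0 k ≤-refl) (sum-applyDownFrom-zero f k (λ r r<k → f≡0 r (m<n⇒m<1+n r<k)))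

sum-applyDownFrom-single : ∀ f k {r₀} → r₀ < k → f r₀ ≡ 1 → (∀ r → r < k → r ≢ r₀ → f r ≡ 0) →
  sum (applyDownFrom f k) ≡ 1
sum-applyDownFrom-single f (suc k) {r₀} r₀<1+k fr₀≡1 f≡0 with m<1+n⇒m<n∨m≡n r₀<1+k
... | inj₁ r₀<k = cong₂ _+_ (f≡0 k ≤-refl (>⇒≢ r₀<k))
                    (sum-applyDownFrom-single f k r₀<k fr₀≡1 (λ r r<k → f≡0 r (m<n⇒m<1+n r<k)))
... | inj₂ refl =
  cong₂ _+_ fr₀≡1 (sum-applyDownFrom-zero f k (λ r r<k → f≡0 r (m<n⇒m<1+n r<k) (<⇒≢ r<k)))

module Presented {k : ℕ} {S : Set} (next : S → Tape k → List S) (accepting rejecting : S → Bool) where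

  paths : (S → Bool) → S → List (Tape k) → ℕ
  paths goal s w with goal s | accepting s | rejecting s
  ... | true  | _     | _     = 1
  ... | false | true  | _     = 0
  ... | false | false | true  = 0
  ... | false | false | false with w
  ...   | []     = 0
  ...   | σ ∷ w' = sum (map (λ s' → paths goal s' w') (next s σ))

  -- States are stored in Fin m through their codes; decode only has to invert encode on
  -- the successors of decoded states.
  module Encoded {m : ℕ} (encode : S → ℕ) (decode : ℕ → S) (start : Fin m)
    (disjoint : ∀ s → T (accepting s) → T (rejecting s) → ⊥)
    (encode-next : ∀ v σ → All (λ s → encode s < m × decode (encode s) ≡ s) (next (decode v) σ))
    (encode-next-unique : ∀ v σ → Unique (map encode (next (decode v) σ)))
    where

    automaton : NFA k m
    automaton = record
      { δ    = λ q σ q' → toℕ q' ∈ᵇ map encode (next (decode (toℕ q)) σ)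
      ; q₀   = start
      ; acc  = λ q → accepting (decode (toℕ q))
      ; rej  = λ q → rejecting (decode (toℕ q))
      ; disj = λ q → disjoint (decode (toℕ q))
      }

    count≡paths : ∀ goal q w →
      count automaton (λ q → goal (decode (toℕ q))) q w ≡ paths goal (decode (toℕ q)) w
    count≡paths goal q w
      with goal (decode (toℕ q)) | accepting (decode (toℕ q)) | rejecting (decode (toℕ q))
    ... | true  | _     | _     = refl
    ... | false | true  | _     = refl
    ... | false | false | true  = refl
    ... | false | false | false with w
    ...   | []     = refl
    ...   | σ ∷ w' = begin
      sumFin m (λ q' → if toℕ q' ∈ᵇ codes then count automaton goal′ q' w' else 0)
        ≡⟨ sumFin-cong m (λ q' → cong (λ c → if toℕ q' ∈ᵇ codes then c else 0)
                                      (count≡paths goal q' w')) ⟩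
      sumFin m (λ q' → if toℕ q' ∈ᵇ codes then paths goal (decode (toℕ q')) w' else 0)
        ≡⟨ sumFin-indicator m codes (λ v → paths goal (decode v) w') (encode-next-unique (toℕ q) σ)
             (All.map⁺ (All.map proj₁ (encode-next (toℕ q) σ))) ⟩
      sum (map (λ v → paths goal (decode v) w') codes)
        ≡⟨ cong sum (≡.sym (map-∘ successors)) ⟩
      sum (map (λ s → paths goal (decode (encode s)) w') successors)
        ≡⟨ cong sum (map-cong-local (All.map (λ e → cong (λ s → paths goal s w') (proj₂ e))
                                             (encode-next (toℕ q) σ))) ⟩
      sum (map (λ s → paths goal s w') successors) ∎
      where
      open ≡-Reasoning
      successors = next (decode (toℕ q)) σ
      codes = map encode successors
      goal′ = λ (q : Fin m) → goal (decode (toℕ q))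

-- Accepting paths and pumping

module AcceptingPaths {k m : ℕ} (M : NFA k m) where
  open NFA M

  Step : Fin m → Tape k → Fin m → Set
  Step q σ q' = acc q ≡ false × rej q ≡ false × δ q σ q' ≡ true

  data Accepts : Fin m → List (Tape k) → Set where
    halt : ∀ {q w} → acc q ≡ true → Accepts q w
    step : ∀ {q σ q' w} → Step q σ q' → Accepts q' w → Accepts q (σ ∷ w)

  data Run : Fin m → List (Tape k) → Fin m → Set where
    []  : ∀ {q} → Run q [] q
    _∷_ : ∀ {q σ q' w p} → Step q σ q' → Run q' w p → Run q (σ ∷ w) p

  accepts⇒count>0 : ∀ {q w} → Accepts q w → count M acc q w > 0
  accepts⇒count>0 (halt acc≡) rewrite acc≡ = s≤s z≤n
  accepts⇒count>0 {q} {σ ∷ w} (step {q' = q'} (acc≡ , rej≡ , δ≡) accepts) rewrite acc≡ | rej≡ =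
    ≤-trans (subst (λ e → (if e then count M acc q' w else 0) > 0) (≡.sym δ≡) (accepts⇒count>0 accepts))
            (≤sumFin m (λ q'' → if δ q σ q'' then count M acc q'' w else 0) q')

  count>0⇒accepts : ∀ q w → count M acc q w > 0 → Accepts q w
  count>0⇒accepts q w pos with acc q in acc≡ | rej q in rej≡
  ... | true | _ = halt acc≡
  count>0⇒accepts q (σ ∷ w) pos | false | false
    with q' , term>0 ← sumFin-positive m _ pos with δ q σ q' in δ≡
  ... | true = step (acc≡ , rej≡ , δ≡) (count>0⇒accepts q' w term>0)

  run-accepts : ∀ {q u p w} → Run q u p → Accepts p w → Accepts q (u ++ w)
  run-accepts []        accepts = accepts
  run-accepts (s ∷ run) accepts = step s (run-accepts run accepts)

  accepts-split : ∀ u {q w} → Accepts q (u ++ w) →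
    (∀ w' → Accepts q (u ++ w')) ⊎ (∃ λ p → Run q u p × Accepts p w)
  accepts-split []      {q} accepts = inj₂ (q , [] , accepts)
  accepts-split (σ ∷ u) (halt acc≡) = inj₁ (λ _ → halt acc≡)
  accepts-split (σ ∷ u) (step s accepts) with accepts-split u accepts
  ... | inj₁ early            = inj₁ (λ w' → step s (early w'))
  ... | inj₂ (p , run , rest) = inj₂ (p , s ∷ run , rest)

  module _ (c : Tape k) where

    stateAt : ∀ {q w p} → Run q w p → ℕ → Fin m
    stateAt {q} _         zero    = q
    stateAt {q} []        (suc i) = q
    stateAt     (_ ∷ run) (suc i) = stateAt run i

    stateAt-end : ∀ n {q p} (run : Run q (replicate n c) p) → stateAt run n ≡ p
    stateAt-end zero    []        = refl
    stateAt-end (suc n) (_ ∷ run) = stateAt-end n run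

    run-between : ∀ n {q p} (run : Run q (replicate n c) p) {i j} → i ≤ j → j ≤ n →
      Run (stateAt run i) (replicate (j ∸ i) c) (stateAt run j)
    run-between n       run       {zero}  {zero}  _         _         = []
    run-between (suc n) (s ∷ run) {zero}  {suc j} _         (s≤s j≤n) = s ∷ run-between n run z≤n j≤n
    run-between (suc n) (s ∷ run) {suc i} {suc j} (s≤s i≤j) (s≤s j≤n) = run-between n run i≤j j≤n

    run-replicate-++ : ∀ i {j q x p} → Run q (replicate i c) x → Run x (replicate j c) p →
      Run q (replicate (i + j) c) p
    run-replicate-++ zero    []        run' = run'
    run-replicate-++ (suc i) (s ∷ run) run' = s ∷ run-replicate-++ i run run'

    run-iterate : ∀ ℓ {x} → Run x (replicate ℓ c) x → ∀ t → Run x (replicate (t * ℓ) c) x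
    run-iterate ℓ loop zero    = []
    run-iterate ℓ loop (suc t) = run-replicate-++ ℓ loop (run-iterate ℓ loop t)

    -- Two of the first m + 1 states of the run coincide, at positions lo < hi ≤ m; the run up
    -- to hi is followed by t extra copies of the loop between lo and hi, then by the rest.
    pumping : ∀ n {q p} → m ≤ n → Run q (replicate n c) p →
      ∃ λ ℓ → 1 ≤ ℓ × ℓ ≤ m × ∀ t → Run q (replicate (n + t * ℓ) c) p
    pumping n {q} {p} m≤n run
      with i , j , i<j , same ← pigeonhole (n<1+n m) (λ i → stateAt run (toℕ i)) =
      ℓ , m<n⇒0<n∸m i<j , ≤-trans (m∸n≤m hi lo) hi≤m , pumped
      where
      lo = toℕ i
      hi = toℕ j
      ℓ = hi ∸ lo
      hi≤m : hi ≤ m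
      hi≤m = ≤-pred (toℕ<n j)
      hi≤n : hi ≤ n
      hi≤n = ≤-trans hi≤m m≤n
      x = stateAt run lo
      loop : Run x (replicate ℓ c) x
      loop = subst (Run x (replicate ℓ c)) (≡.sym same) (run-between n run (<⇒≤ i<j) hi≤n)
      prefix : Run q (replicate hi c) x
      prefix = subst (Run q (replicate hi c)) (≡.sym same) (run-between n run z≤n hi≤n)
      suffix : Run x (replicate (n ∸ hi) c) p
      suffix = subst₂ (λ u v → Run u (replicate (n ∸ hi) c) v) (≡.sym same) (stateAt-end n run)
                      (run-between n run hi≤n ≤-refl)
      length≡ : ∀ t → hi + (t * ℓ + (n ∸ hi)) ≡ n + t * ℓ
      length≡ t = begin
        hi + (t * ℓ + (n ∸ hi))  ≡⟨ cong (hi +_) (+-comm (t * ℓ) (n ∸ hi)) ⟩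
        hi + ((n ∸ hi) + t * ℓ)  ≡⟨ +-assoc hi (n ∸ hi) (t * ℓ) ⟨
        hi + (n ∸ hi) + t * ℓ    ≡⟨ cong (_+ t * ℓ) (m+[n∸m]≡n hi≤n) ⟩
        n + t * ℓ                ∎
        where open ≡-Reasoning
      pumped : ∀ t → Run q (replicate (n + t * ℓ) c) p
      pumped t = subst (λ l → Run q (replicate l c) p) (length≡ t)
        (run-replicate-++ hi prefix (run-replicate-++ (t * ℓ) (run-iterate ℓ loop t) suffix))

    replicate-+-++ : ∀ i j w → replicate (i + j) c ++ w ≡ replicate i c ++ (replicate j c ++ w)
    replicate-+-++ zero    j w = refl
    replicate-+-++ (suc i) j w = cong (c ∷_) (replicate-+-++ i j w)

    accepts-pumping : ∀ u n {w q} → m ≤ n → Accepts q (u ++ (replicate n c ++ w)) →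
      ∃ λ ℓ → 1 ≤ ℓ × ℓ ≤ m × ∀ t → Accepts q (u ++ (replicate (n + t * ℓ) c ++ w))
    accepts-pumping u n {w} {q} m≤n accepts with accepts-split u accepts
    ... | inj₁ early = 1 , ≤-refl , ≤-trans (s≤s z≤n) (toℕ<n q) , λ _ → early _
    ... | inj₂ (p , run , rest) with accepts-split (replicate n c) rest
    ...   | inj₁ early = 1 , ≤-refl , ≤-trans (s≤s z≤n) (toℕ<n q) , λ t →
              run-accepts run (subst (Accepts p) (≡.sym (replicate-+-++ n (t * 1) w)) (early _))
    ...   | inj₂ (p' , run' , rest') with ℓ , 1≤ℓ , ℓ≤m , pumped ← pumping n m≤n run' =
              ℓ , 1≤ℓ , ℓ≤m , λ t → run-accepts run (run-accepts (pumped t) rest')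

coprime-* : ∀ {x y z} → Coprime x y → Coprime x z → Coprime x (y * z)
coprime-* {y = y} x⊥y x⊥z {d} (d∣x , d∣yz) = x⊥z (d∣x , coprime-divisor d⊥y d∣yz)
  where
  d⊥y : Coprime d y
  d⊥y (e∣d , e∣y) = x⊥y (∣-trans e∣d d∣x , e∣y)

coprime-product : ∀ {x ns} → All (Coprime x) ns → Coprime x (product ns)
coprime-product []           = Coprime.sym (Coprime.1-coprimeTo _)
coprime-product (x⊥n ∷ x⊥ns) = coprime-* x⊥n (coprime-product x⊥ns)

coprime-*-∣ : ∀ {x y n} → Coprime x y → x ∣ n → y ∣ n → x * y ∣ n
coprime-*-∣ {x} {y} x⊥y x∣n (divides q refl)
  with divides q′ refl ← coprime-divisor x⊥y (subst (x ∣_) (*-comm q y) x∣n) =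
  divides q′ (*-assoc q′ x y)

product-∣ : ∀ {ns n} → AllPairs Coprime ns → All (_∣ n) ns → product ns ∣ n
product-∣ []                []           = 1∣ _
product-∣ (d⊥ds ∷ pairwise) (d∣n ∷ ds∣n) =
  coprime-*-∣ (coprime-product d⊥ds) d∣n (product-∣ pairwise ds∣n)

^length≤product : ∀ {x ns} → All (x ≤_) ns → x ^ length ns ≤ product ns
^length≤product []           = ≤-refl
^length≤product (x≤n ∷ x≤ns) = *-mono-≤ x≤n (^length≤product x≤ns)

∣! : ∀ {j n} → 0 < j → j ≤ n → j ∣ n !
∣! {suc j} _ j≤n = ∣-trans (m∣m*n (j !)) (m≤n⇒m!∣n! j≤n)

-- A common divisor e divides (1 + s)(1 + (1 + r) N!) − (1 + r)(1 + (1 + s) N!) = s − r,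
-- hence N!, hence 1.
coprime-1+*! : ∀ N {r s} → r < s → s ≤ N → Coprime (suc (suc r * N !)) (suc (suc s * N !))
coprime-1+*! N {r} {s} r<s s≤N {e} (e∣x , e∣y) =
  ∣1⇒≡1 (∣m+n∣m⇒∣n (subst (e ∣_) (+-comm 1 _) e∣x) (∣n⇒∣m*n (suc r) e∣N!))
  where
  δ = s ∸ r
  identity : ∀ r δ F → suc (r + δ) * suc (suc r * F) ≡ suc r * suc (suc (r + δ) * F) + δ
  identity = solve-∀
  difference : suc s * suc (suc r * N !) ≡ suc r * suc (suc s * N !) + δ
  difference = subst (λ z → suc z * suc (suc r * N !) ≡ suc r * suc (suc z * N !) + δ)
                     (m+[n∸m]≡n (<⇒≤ r<s)) (identity r δ (N !))
  e∣N! : e ∣ N !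
  e∣N! = ∣-trans (∣m+n∣m⇒∣n (subst (e ∣_) difference (∣n⇒∣m*n (suc s) e∣x)) (∣n⇒∣m*n (suc r) e∣y))
                 (∣! (m<n⇒0<n∸m r<s) (≤-trans (m∸n≤m s r) s≤N))

[m%d+n]%d≡[m+n]%d : ∀ m n d .{{_ : NonZero d}} → (m % d + n) % d ≡ (m + n) % d
[m%d+n]%d≡[m+n]%d m n d = begin
  (m % d + n) % d          ≡⟨ %-distribˡ-+ (m % d) n d ⟩
  (m % d % d + n % d) % d  ≡⟨ cong (λ x → (x + n % d) % d) (m%n%n≡m%n m d) ⟩
  (m % d + n % d) % d      ≡⟨ %-distribˡ-+ m n d ⟨
  (m + n) % d              ∎
  where open ≡-Reasoning

signum : ℕ → ℕ
signum zero    = 0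
signum (suc _) = 1

signum-%-∣ : ∀ {d m} .{{_ : NonZero d}} → d ∣ m → signum (m % d) ≡ 0
signum-%-∣ {d} {m} d∣m rewrite n∣m⇒m%n≡0 m d d∣m = refl

signum-%-∤ : ∀ {d m} .{{_ : NonZero d}} → ¬ d ∣ m → signum (m % d) ≡ 1
signum-%-∤ {d} {m} d∤m with m % d in m%d≡
... | zero  = ⊥-elim (d∤m (m%n≡0⇒n∣m m d m%d≡))
... | suc _ = refl

-- The moduli

-- Opaque, so that the type checker never unfolds the factorial into a huge normal form.
opaque
  base : ℕ → ℕ
  base D = (3 + D) !

  base-suc : ∀ D → base (suc D) ≡ (4 + D) * base D
  base-suc D = refl

  4+D≤base : ∀ D → 4 + D ≤ base D
  4+D≤base D = begin
    4 + D            ≤⟨ m≤m+n (4 + D) (2 + D) ⟩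
    4 + D + (2 + D)  ≡⟨ double D ⟨
    (3 + D) * 2      ≤⟨ *-monoʳ-≤ (3 + D) (*-mono-≤ (m≤m+n 2 D) (1≤n! (1 + D))) ⟩
    (3 + D) !        ∎
    where
    open ≤-Reasoning
    double : ∀ D → (3 + D) * 2 ≡ 4 + D + (2 + D)
    double = solve-∀

  base-mono : ∀ {D D'} → D ≤ D' → base D ≤ base D'
  base-mono {D' = D'} D≤D' = ∣⇒≤ {{(3 + D') !≢0}} (m≤n⇒m!∣n! (+-monoʳ-≤ 3 D≤D'))

  coprime-1+*base : ∀ D {r s} → r < s → s < D →
    Coprime (suc (suc r * base D)) (suc (suc s * base D))
  coprime-1+*base D r<s s<D = coprime-1+*! (3 + D) r<s (≤-trans (<⇒≤ s<D) (m≤n+m D 3))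

base≢0 : ∀ D → NonZero (base D)
base≢0 D = >-nonZero (≤-trans (s≤s z≤n) (4+D≤base D))

modulus : ℕ → ℕ → ℕ
modulus D r = suc (suc r * base D)

moduli : ℕ → List ℕ
moduli D = applyDownFrom (modulus D) D

modulus-coprime : ∀ D {r s} → r < D → s < D → r ≢ s → Coprime (modulus D r) (modulus D s)
modulus-coprime D {r} {s} r<D s<D r≢s with <-cmp r s
... | tri< r<s _ _ = coprime-1+*base D r<s s<D
... | tri≈ _ r≡s _ = ⊥-elim (r≢s r≡s)
... | tri> _ _ s<r = Coprime.sym (coprime-1+*base D s<r r<D)

moduli-coprime : ∀ D → AllPairs Coprime (moduli D)
moduli-coprime D = AllPairs.applyDownFrom⁺₁ (modulus D) D
  (λ j<i i<D → modulus-coprime D i<D (<-trans j<i i<D) (>⇒≢ j<i))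

base^D≤product-moduli : ∀ D → base D ^ D ≤ product (moduli D)
base^D≤product-moduli D =
  subst (λ l → base D ^ l ≤ product (moduli D)) (length-applyDownFrom (modulus D) D)
    (^length≤product (All.applyDownFrom⁺₂ (modulus D) D base≤modulus))
  where
  base≤modulus : ∀ r → base D ≤ modulus D r
  base≤modulus r = ≤-trans (m≤m+n (base D) (r * base D)) (n≤1+n _)

<product-moduli⇒∃modulus∤ : ∀ D {ℓ} → 0 < ℓ → ℓ < product (moduli D) → ∃ λ r → r < D × ¬ modulus D r ∣ ℓ
<product-moduli⇒∃modulus∤ D {ℓ} 0<ℓ ℓ<P with all? (_∣? ℓ) (moduli D)
... | yes all∣ = ⊥-elim (<⇒≱ ℓ<P (∣⇒≤ {{>-nonZero 0<ℓ}} (product-∣ (moduli-coprime D) all∣)))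
... | no ¬all∣ = Any.applyDownFrom⁻ (modulus D) (All.¬All⇒Any¬ (_∣? ℓ) (moduli D) ¬all∣)

otherModuli : ℕ → ℕ → List ℕ
otherModuli D r₀ = map (modulus D) (filter (λ r → ¬? (r ≟ r₀)) (downFrom D))

∣product-otherModuli : ∀ D {r₀ r} → r < D → r ≢ r₀ → modulus D r ∣ product (otherModuli D r₀)
∣product-otherModuli D r<D r≢r₀ =
  ∈⇒∣product (∈-map⁺ (modulus D) (∈-filter⁺ (λ r → ¬? (r ≟ _)) (∈-downFrom⁺ r<D) r≢r₀))

coprime-product-otherModuli : ∀ D {r₀} → r₀ < D → Coprime (modulus D r₀) (product (otherModuli D r₀))
coprime-product-otherModuli D {r₀} r₀<D = coprime-product (All.map⁺ (All.tabulate coprime))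
  where
  coprime : ∀ {r} → r ∈ filter (λ r → ¬? (r ≟ r₀)) (downFrom D) → Coprime (modulus D r₀) (modulus D r)
  coprime r∈ with r∈downFrom , r≢r₀ ← ∈-filter⁻ (λ r → ¬? (r ≟ r₀)) r∈ =
    modulus-coprime D r₀<D (∈-downFrom⁻ r∈downFrom) (≢-sym r≢r₀)

width : ℕ → ℕ
width D = base D * base D

stateCount : ℕ → ℕ
stateCount D = suc D * width D

base≤width : ∀ D → base D ≤ width D
base≤width D = m≤m*n (base D) (base D) {{base≢0 D}}

3+k<width : ∀ {D k} → k ≤ D → 3 + k < width D
3+k<width {D} k≤D = ≤-trans (+-monoʳ-≤ 4 k≤D) (≤-trans (4+D≤base D) (base≤width D))

modulus<width : ∀ {D r} → r < D → modulus D r < width D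
modulus<width {D} {r} r<D = begin-strict
  suc (suc r * M)  ≤⟨ s≤s (*-monoˡ-≤ M r<D) ⟩
  1 + D * M        <⟨ +-monoˡ-< (D * M) (≤-trans (s≤s (s≤s z≤n)) (4+D≤base D)) ⟩
  suc D * M        ≤⟨ *-monoˡ-≤ M (≤-trans (m≤n+m (suc D) 3) (4+D≤base D)) ⟩
  M * M            ∎
  where
  open ≤-Reasoning
  M = base D

stateCount-mono : ∀ {D D'} → D ≤ D' → stateCount D ≤ stateCount D'
stateCount-mono D≤D' = *-mono-≤ (s≤s D≤D') (*-mono-≤ (base-mono D≤D') (base-mono D≤D'))

stateCount-< : ∀ D → stateCount D < stateCount (suc D)
stateCount-< D = begin-strict
  suc D * width D  ≤⟨ *-monoʳ-≤ (suc D) (*-mono-≤ (base-mono (n≤1+n D)) (base-mono (n≤1+n D))) ⟩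
  suc D * W        <⟨ m<n+m (suc D * W) 0<W ⟩
  W + suc D * W    ∎
  where
  open ≤-Reasoning
  W = width (suc D)
  0<W : 0 < W
  0<W = ≤-trans (s≤s z≤n) (≤-trans (4+D≤base (suc D)) (base≤width (suc D)))

stateCount-suc≤base^5 : ∀ D → stateCount (suc D) ≤ base D ^ 5
stateCount-suc≤base^5 D = begin
  (2 + D) * (base (suc D) * base (suc D))
    ≤⟨ *-mono-≤ (≤-trans (m≤n+m (2 + D) 2) (4+D≤base D)) (*-mono-≤ base-suc≤ base-suc≤) ⟩
  M * ((M * M) * (M * M))
    ≡⟨ fifth-power M ⟩
  M ^ 5 ∎
  where
  open ≤-Reasoning
  M = base D
  base-suc≤ : base (suc D) ≤ M * M
  base-suc≤ = ≤-trans (≤-reflexive (base-suc D)) (*-monoˡ-≤ M (4+D≤base D))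
  fifth-power : ∀ M → M * ((M * M) * (M * M)) ≡ M * (M * (M * (M * (M * 1))))
  fifth-power = solve-∀

evalPoly-mono : ∀ cs {x y} → x ≤ y → evalPoly cs x ≤ evalPoly cs y
evalPoly-mono []       x≤y = z≤n
evalPoly-mono (c ∷ cs) x≤y = +-monoʳ-≤ c (*-mono-≤ x≤y (evalPoly-mono cs x≤y))

evalPoly≤ : ∀ cs {x} → 1 ≤ x → evalPoly cs x ≤ sum cs * x ^ length cs
evalPoly≤ []       _   = z≤n
evalPoly≤ (c ∷ cs) {x} 1≤x = begin
  c + x * evalPoly cs x            ≤⟨ +-mono-≤ c≤ (*-monoʳ-≤ x (evalPoly≤ cs 1≤x)) ⟩
  c * x ^ suc L + x * (S * x ^ L)  ≡⟨ collect c S x (x ^ L) ⟩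
  (c + S) * x ^ suc L              ∎
  where
  open ≤-Reasoning
  L = length cs
  S = sum cs
  collect : ∀ c S x y → c * (x * y) + x * (S * y) ≡ (c + S) * (x * y)
  collect = solve-∀
  c≤ : c ≤ c * x ^ suc L
  c≤ = m≤m*n c (x ^ suc L) {{m^n≢0 x (suc L) {{>-nonZero 1≤x}}}}

polynomial<product-moduli : ∀ cs → ∃ λ D₀ → ∀ D → D₀ ≤ D →
  evalPoly cs (stateCount (suc D)) < product (moduli D)
polynomial<product-moduli cs = suc (C + 5 * L) , bound
  where
  C = sum cs
  L = length cs
  bound : ∀ D → suc (C + 5 * L) ≤ D → evalPoly cs (stateCount (suc D)) < product (moduli D)
  bound D D₀≤D = begin-strict
    evalPoly cs (stateCount (suc D))  ≤⟨ evalPoly-mono cs (stateCount-suc≤base^5 D) ⟩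
    evalPoly cs (M ^ 5)               ≤⟨ evalPoly≤ cs (^-monoˡ-≤ 5 (≤-trans (s≤s z≤n) (4+D≤base D))) ⟩
    C * (M ^ 5) ^ L                   ≡⟨ cong (C *_) (^-*-assoc M 5 L) ⟩
    C * M ^ (5 * L)                   <⟨ *-monoˡ-< (M ^ (5 * L)) {{m^n≢0 M (5 * L) {{base≢0 D}}}} C<M ⟩
    M ^ suc (5 * L)                   ≤⟨ ^-monoʳ-≤ M {{base≢0 D}} 5L<D ⟩
    M ^ D                             ≤⟨ base^D≤product-moduli D ⟩
    product (moduli D)                ∎
    where
    open ≤-Reasoning
    M = base D
    5L<D : 5 * L < D
    5L<D = ≤-trans (s≤s (m≤n+m (5 * L) C)) D₀≤D
    C<M : C < M
    C<M = ≤-trans (s≤s (≤-trans (m≤m+n C (5 * L)) (≤-trans (n≤1+n _) D₀≤D)))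
                  (≤-trans (m≤n+m (suc D) 3) (4+D≤base D))

-- The largest D with stateCount D ≤ n + stateCount 0 (the offset makes dimension 0 = 0 fit).
dimension : ℕ → ℕ
dimension zero = 0
dimension (suc n) with stateCount (suc (dimension n)) ≤? suc n + stateCount 0
... | yes _ = suc (dimension n)
... | no  _ = dimension n

dimension-bounds : ∀ n →
  stateCount (dimension n) ≤ n + stateCount 0 × n + stateCount 0 < stateCount (suc (dimension n))
dimension-bounds zero = ≤-refl , stateCount-< 0
dimension-bounds (suc n) with dimension-bounds n | stateCount (suc (dimension n)) ≤? suc n + stateCount 0
... | _ , above | yes fits  = fits , ≤-trans (s≤s above) (stateCount-< (suc (dimension n)))
... | below , _ | no  ¬fits = ≤-trans below (n≤1+n _) , ≰⇒> ¬fits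

dimension-unbounded : ∀ D → D ≤ dimension (stateCount D)
dimension-unbounded D with D ≤? dimension (stateCount D)
... | yes D≤ = D≤
... | no  D≰ = ⊥-elim (<⇒≱ (proj₂ (dimension-bounds (stateCount D)))
                          (≤-trans (stateCount-mono (≰⇒> D≰)) (m≤m+n _ _)))

-- The gap automaton

pattern a = zero
pattern b = suc zero

data State : Set where
  start accept reject : State
  choose  : ℕ → State
  residue : ℕ → ℕ → State

accepting : State → Bool
accepting accept = true
accepting _      = false

rejecting : State → Bool
rejecting reject = true
rejecting _      = false

nonDivisorCount : ℕ → ℕ → ℕ → ℕ
nonDivisorCount D k m = sum (applyDownFrom (λ r → signum (m % modulus D r)) k)

a^_◁ : ℕ → List (Tape 2)
a^ m ◁ = replicate m (sym a) ++ [ rend ]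

b^_a^_◁ : ℕ → ℕ → List (Tape 2)
b^ k a^ m ◁ = replicate k (sym b) ++ a^ m ◁

word : ℕ → ℕ → List (Fin 2)
word D m = replicate D b ++ replicate m a

tape-word : ∀ D m → tape (word D m) ≡ lend ∷ b^ D a^ m ◁
tape-word D m = cong (lend ∷_) (begin
    map sym (replicate D b ++ replicate m a) ++ [ rend ]
      ≡⟨ cong (_++ [ rend ]) (map-++ sym (replicate D b) (replicate m a)) ⟩
    (map sym (replicate D b) ++ map sym (replicate m a)) ++ [ rend ]
      ≡⟨ ++-assoc (map sym (replicate D b)) _ _ ⟩
    map sym (replicate D b) ++ (map sym (replicate m a) ++ [ rend ])
      ≡⟨ cong₂ (λ u v → u ++ (v ++ [ rend ])) (map-replicate sym D b) (map-replicate sym m a) ⟩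
    b^ D a^ m ◁ ∎)
  where open ≡-Reasoning

module GapAutomaton (D : ℕ) where

  instance
    width≢0 : NonZero (width D)
    width≢0 = m*n≢0 (base D) (base D) {{base≢0 D}} {{base≢0 D}}

  -- choose k has k b's left to read before the block of a's and may commit to the modulus
  -- with index k − 1; choose 0 accepts on aᵐ◁; residue r i holds the number of a's read
  -- modulo dᵣ and rejects at ◁ iff it is nonzero.
  next : State → Tape 2 → List State
  next start              lend    = [ choose D ]
  next (choose zero)      (sym a) = [ choose zero ]
  next (choose zero)      rend    = [ accept ]
  next (choose (suc k))   (sym b) = residue k 0 ∷ choose k ∷ []
  next (residue r i)      (sym a) = [ residue r (suc i % modulus D r) ]
  next (residue r i)      (sym b) = [ residue r i ]
  next (residue r (suc _)) rend   = [ reject ]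
  next _                  _       = []

  -- Codes below width D hold start, accept, reject and the choose states; block r + 1 of
  -- length width D holds the residues modulo dᵣ.  Codes of no state decode to start.
  encode : State → ℕ
  encode start         = 0
  encode accept        = 1
  encode reject        = 2
  encode (choose k)    = 3 + k
  encode (residue r i) = i + suc r * width D

  decodeLow : ℕ → State
  decodeLow 0 = start
  decodeLow 1 = accept
  decodeLow 2 = reject
  decodeLow (suc (suc (suc k))) with k ≤? D
  ... | yes _ = choose k
  ... | no  _ = start

  decodeResidue : ℕ → ℕ → State
  decodeResidue r i with r <? D | i <? modulus D r
  ... | yes _ | yes _ = residue r i
  ... | _     | _     = start

  decode : ℕ → State
  decode v with v <? width D
  ... | yes _ = decodeLow v
  ... | no  _ = decodeResidue (v / width D ∸ 1) (v % width D)

  data Legal : State → Set where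
    start   : Legal start
    accept  : Legal accept
    reject  : Legal reject
    choose  : ∀ {k} → k ≤ D → Legal (choose k)
    residue : ∀ {r i} → r < D → i < modulus D r → Legal (residue r i)

  residue-code/ : ∀ r {i} → i < width D → (i + suc r * width D) / width D ∸ 1 ≡ r
  residue-code/ r {i} i<W = cong (_∸ 1) (begin
    (i + suc r * width D) / width D          ≡⟨ +-distrib-/-∣ʳ i {d = width D} (n∣m*n (suc r)) ⟩
    i / width D + suc r * width D / width D  ≡⟨ cong₂ _+_ (m<n⇒m/n≡0 i<W) (m*n/n≡m (suc r) (width D)) ⟩
    suc r                                    ∎)
    where open ≡-Reasoning

  residue-code% : ∀ r {i} → i < width D → (i + suc r * width D) % width D ≡ i
  residue-code% r {i} i<W = trans ([m+kn]%n≡m%n i (suc r) (width D)) (m<n⇒m%n≡m i<W)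

  decode-low : ∀ {v} → v < width D → decode v ≡ decodeLow v
  decode-low {v} v<W with v <? width D
  ... | yes _ = refl
  ... | no v≮W = ⊥-elim (v≮W v<W)

  decode-high : ∀ {v} → width D ≤ v → decode v ≡ decodeResidue (v / width D ∸ 1) (v % width D)
  decode-high {v} W≤v with v <? width D
  ... | yes v<W = ⊥-elim (<⇒≱ v<W W≤v)
  ... | no _ = refl

  decode-encode : ∀ {s} → Legal s → decode (encode s) ≡ s
  decode-encode start  = decode-low (≤-trans (s≤s z≤n) (3+k<width z≤n))
  decode-encode accept = decode-low (≤-trans (s≤s (s≤s z≤n)) (3+k<width z≤n))
  decode-encode reject = decode-low (≤-trans (s≤s (s≤s (s≤s z≤n))) (3+k<width z≤n))
  decode-encode (choose {k} k≤D) rewrite decode-low (3+k<width k≤D) with k ≤? D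
  ... | yes _   = refl
  ... | no k≰D = ⊥-elim (k≰D k≤D)
  decode-encode (residue {r} {i} r<D i<d)
    rewrite decode-high (≤-trans (m≤m+n (width D) (r * width D)) (m≤n+m _ i))
          | residue-code/ r (<-trans i<d (modulus<width r<D))
          | residue-code% r (<-trans i<d (modulus<width r<D))
    with r <? D | i <? modulus D r
  ... | yes _  | yes _  = refl
  ... | no r≮D | _      = ⊥-elim (r≮D r<D)
  ... | yes _  | no i≮d = ⊥-elim (i≮d i<d)

  decode-legal : ∀ v → Legal (decode v)
  decode-legal v with v <? width D
  ... | yes _ = low v
    where
    low : ∀ v → Legal (decodeLow v)
    low 0 = start
    low 1 = accept
    low 2 = reject
    low (suc (suc (suc k))) with k ≤? D
    ... | yes k≤D = choose k≤D
    ... | no  _   = start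
  ... | no  _ = high (v / width D ∸ 1) (v % width D)
    where
    high : ∀ r i → Legal (decodeResidue r i)
    high r i with r <? D | i <? modulus D r
    ... | yes r<D | yes i<d = residue r<D i<d
    ... | yes _   | no  _   = start
    ... | no  _   | _       = start

  low<stateCount : ∀ {k} → k ≤ D → 3 + k < stateCount D
  low<stateCount k≤D = ≤-trans (3+k<width k≤D) (m≤m+n (width D) (D * width D))

  encode<stateCount : ∀ {s} → Legal s → encode s < stateCount D
  encode<stateCount start        = ≤-trans (s≤s z≤n) (low<stateCount z≤n)
  encode<stateCount accept       = ≤-trans (s≤s (s≤s z≤n)) (low<stateCount z≤n)
  encode<stateCount reject       = ≤-trans (s≤s (s≤s (s≤s z≤n))) (low<stateCount z≤n)
  encode<stateCount (choose k≤D) = low<stateCount k≤D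
  encode<stateCount (residue {r} {i} r<D i<d) = begin-strict
    i + suc r * width D     <⟨ +-monoˡ-< (suc r * width D) (<-trans i<d (modulus<width r<D)) ⟩
    suc (suc r) * width D   ≤⟨ *-monoˡ-≤ (width D) (s≤s r<D) ⟩
    stateCount D            ∎
    where open ≤-Reasoning

  none : All Legal [] × Unique (map encode [])
  none = [] , []

  only : ∀ {s} → Legal s → All Legal [ s ] × Unique (map encode [ s ])
  only legal = legal ∷ [] , [] ∷ []

  next-wellformed : ∀ {s} → Legal s → ∀ σ → All Legal (next s σ) × Unique (map encode (next s σ))
  next-wellformed start lend = only (choose ≤-refl)
  next-wellformed start (sym _) = none
  next-wellformed start rend = none
  next-wellformed accept _ = none
  next-wellformed reject _ = none
  next-wellformed (choose {zero} _) lend = none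
  next-wellformed (choose {zero} _) (sym a) = only (choose z≤n)
  next-wellformed (choose {zero} _) (sym b) = none
  next-wellformed (choose {zero} _) rend = only accept
  next-wellformed (choose {suc k} _) lend = none
  next-wellformed (choose {suc k} _) (sym a) = none
  next-wellformed (choose {suc k} k<D) (sym b) =
    residue k<D (s≤s z≤n) ∷ choose (<⇒≤ k<D) ∷ [] , (residue≢choose ∷ []) ∷ [] ∷ []
    where
    residue≢choose : 0 + suc k * width D ≢ 3 + k
    residue≢choose eq =
      <⇒≱ (3+k<width (<⇒≤ k<D)) (≤-trans (m≤m+n (width D) (k * width D)) (≤-reflexive eq))
  next-wellformed (choose {suc k} _) rend = none
  next-wellformed (residue r<D i<d) lend = none
  next-wellformed (residue {r} {i} r<D i<d) (sym a) = only (residue r<D (m%n<n (suc i) (modulus D r)))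
  next-wellformed (residue r<D i<d) (sym b) = only (residue r<D i<d)
  next-wellformed (residue {i = zero} r<D i<d) rend = none
  next-wellformed (residue {i = suc _} r<D i<d) rend = only reject

  disjoint : ∀ s → T (accepting s) → T (rejecting s) → ⊥
  disjoint accept _ ()
  disjoint reject ()

  encode-next : ∀ v σ →
    All (λ s → encode s < stateCount D × decode (encode s) ≡ s) (next (decode v) σ)
  encode-next v σ = All.map (λ legal → encode<stateCount legal , decode-encode legal)
                            (proj₁ (next-wellformed (decode-legal v) σ))

  encode-next-unique : ∀ v σ → Unique (map encode (next (decode v) σ))
  encode-next-unique v σ = proj₂ (next-wellformed (decode-legal v) σ)

  initial : Fin (stateCount D)
  initial = fromℕ< (encode<stateCount start)

  decode-initial : decode (toℕ initial) ≡ start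
  decode-initial = trans (cong decode (toℕ-fromℕ< (encode<stateCount start))) (decode-encode start)

  open Presented next accepting rejecting
  open Encoded encode decode initial disjoint encode-next encode-next-unique

  gapAutomaton : NFA 2 (stateCount D)
  gapAutomaton = automaton

  accepting-residue : ∀ r i w → paths accepting (residue r i) w ≡ 0
  accepting-residue r i       []          = refl
  accepting-residue r i       (lend ∷ w)  = refl
  accepting-residue r i       (sym a ∷ w) = trans (+-identityʳ _) (accepting-residue r _ w)
  accepting-residue r i       (sym b ∷ w) = trans (+-identityʳ _) (accepting-residue r i w)
  accepting-residue r zero    (rend ∷ w)  = refl
  accepting-residue r (suc i) (rend ∷ w)  = refl

  accepting-choose : ∀ k m → paths accepting (choose k) (b^ k a^ m ◁) ≡ 1
  accepting-choose zero    zero    = refl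
  accepting-choose zero    (suc m) = trans (+-identityʳ _) (accepting-choose zero m)
  accepting-choose (suc k) m       =
    cong₂ _+_ (accepting-residue k 0 (b^ k a^ m ◁)) (trans (+-identityʳ _) (accepting-choose k m))

  rejecting-residue-b : ∀ r i k w →
    paths rejecting (residue r i) (replicate k (sym b) ++ w) ≡ paths rejecting (residue r i) w
  rejecting-residue-b r i zero    w = refl
  rejecting-residue-b r i (suc k) w = trans (+-identityʳ _) (rejecting-residue-b r i k w)

  rejecting-residue-a : ∀ r j {i} → i < modulus D r →
    paths rejecting (residue r i) (a^ j ◁) ≡ signum ((i + j) % modulus D r)
  rejecting-residue-a r zero {i} i<d rewrite +-identityʳ i | m<n⇒m%n≡m i<d with i
  ... | zero  = refl
  ... | suc _ = refl
  rejecting-residue-a r (suc j) {i} i<d = begin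
    paths rejecting (residue r (suc i % d)) (a^ j ◁) + 0
      ≡⟨ +-identityʳ _ ⟩
    paths rejecting (residue r (suc i % d)) (a^ j ◁)
      ≡⟨ rejecting-residue-a r j (m%n<n (suc i) d) ⟩
    signum ((suc i % d + j) % d)
      ≡⟨ cong signum ([m%d+n]%d≡[m+n]%d (suc i) j d) ⟩
    signum ((suc i + j) % d)
      ≡⟨ cong (λ n → signum (n % d)) (+-suc i j) ⟨
    signum ((i + suc j) % d) ∎
    where
    open ≡-Reasoning
    d = modulus D r

  rejecting-choose : ∀ k m → paths rejecting (choose k) (b^ k a^ m ◁) ≡ nonDivisorCount D k m
  rejecting-choose zero    zero    = refl
  rejecting-choose zero    (suc m) = trans (+-identityʳ _) (rejecting-choose zero m)
  rejecting-choose (suc k) m       = cong₂ _+_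
    (trans (rejecting-residue-b k 0 k _) (rejecting-residue-a k m (s≤s z≤n)))
    (trans (+-identityʳ _) (rejecting-choose k m))

  paths-word : ∀ goal m → count automaton (λ q → goal (decode (toℕ q))) initial (tape (word D m))
                         ≡ paths goal start (lend ∷ b^ D a^ m ◁)
  paths-word goal m = trans (count≡paths goal initial (tape (word D m)))
                            (cong₂ (paths goal) decode-initial (tape-word D m))

  #acc-word : ∀ m → #acc gapAutomaton (word D m) ≡ 1
  #acc-word m = trans (paths-word accepting m) (trans (+-identityʳ _) (accepting-choose D m))

  #rej-word : ∀ m → #rej gapAutomaton (word D m) ≡ nonDivisorCount D D m
  #rej-word m = trans (paths-word rejecting m) (trans (+-identityʳ _) (rejecting-choose D m))

-- The promise problems

CommonMultiple : ℕ → ℕ → Set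
CommonMultiple D m = ∀ r → r < D → modulus D r ∣ m

CommonMultipleExcept : ℕ → ℕ → ℕ → Set
CommonMultipleExcept D r₀ m = r₀ < D × ¬ modulus D r₀ ∣ m × (∀ r → r < D → r ≢ r₀ → modulus D r ∣ m)

nonDivisorCount-common : ∀ D {m} → CommonMultiple D m → nonDivisorCount D D m ≡ 0
nonDivisorCount-common D common = sum-applyDownFrom-zero _ D (λ r r<D → signum-%-∣ (common r r<D))

nonDivisorCount-except : ∀ D {r₀ m} → CommonMultipleExcept D r₀ m → nonDivisorCount D D m ≡ 1
nonDivisorCount-except D (r₀<D , r₀∤m , others) =
  sum-applyDownFrom-single _ D r₀<D (signum-%-∤ r₀∤m) (λ r r<D r≢r₀ → signum-%-∣ (others r r<D r≢r₀))

commonMultiple-*product : ∀ D s → CommonMultiple D (s * product (moduli D))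
commonMultiple-*product D s r r<D = ∣n⇒∣m*n s (∈⇒∣product (∈-applyDownFrom⁺ (modulus D) r<D))

commonMultipleExcept-shift : ∀ D {m r₀ ℓ} → CommonMultiple D m → r₀ < D → ¬ modulus D r₀ ∣ ℓ →
  CommonMultipleExcept D r₀ (m + product (otherModuli D r₀) * ℓ)
commonMultipleExcept-shift D {m} {r₀} {ℓ} common r₀<D r₀∤ℓ = r₀<D , r₀∤shifted , others
  where
  r₀∤shifted : ¬ modulus D r₀ ∣ m + product (otherModuli D r₀) * ℓ
  r₀∤shifted r₀∣ = r₀∤ℓ (coprime-divisor (coprime-product-otherModuli D r₀<D)
                                         (∣m+n∣m⇒∣n r₀∣ (common r₀ r₀<D)))
  others : ∀ r → r < D → r ≢ r₀ → modulus D r ∣ m + product (otherModuli D r₀) * ℓ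
  others r r<D r≢r₀ = ∣m∣n⇒∣m+n (common r r<D) (∣m⇒∣m*n ℓ (∣product-otherModuli D r<D r≢r₀))

module _ {s} (M : NFA 2 s) (D : ℕ) where
  open AcceptingPaths M

  small-automaton-accepts-near-multiple : s < product (moduli D) →
    #acc M (word D (s * product (moduli D))) > 0 →
    ∃ λ m → (∃ λ r₀ → CommonMultipleExcept D r₀ m) × #acc M (word D m) > 0
  small-automaton-accepts-near-multiple s<P accepted =
    missing (accepts-pumping (sym a) (lend ∷ replicate D (sym b)) m s≤m
              (subst (Accepts (NFA.q₀ M)) (tape-word D m) (count>0⇒accepts (NFA.q₀ M) _ accepted)))
    where
    P = product (moduli D)
    m = s * P
    s≤m : s ≤ m
    s≤m = m≤m*n s P {{>-nonZero (≤-<-trans z≤n s<P)}}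
    missing : (∃ λ ℓ → 1 ≤ ℓ × ℓ ≤ s × ∀ t → Accepts (NFA.q₀ M) (lend ∷ b^ D a^ (m + t * ℓ) ◁)) →
      ∃ λ m → (∃ λ r₀ → CommonMultipleExcept D r₀ m) × #acc M (word D m) > 0
    missing (ℓ , 1≤ℓ , ℓ≤s , pumped)
      with r₀ , r₀<D , r₀∤ℓ ← <product-moduli⇒∃modulus∤ D 1≤ℓ (≤-<-trans ℓ≤s s<P) =
      m + t * ℓ , (r₀ , commonMultipleExcept-shift D (commonMultiple-*product D s) r₀<D r₀∤ℓ) ,
      subst (λ w → count M (NFA.acc M) (NFA.q₀ M) w > 0) (≡.sym (tape-word D (m + t * ℓ)))
            (accepts⇒count>0 (pumped t))
      where t = product (otherModuli D r₀)

word-injective : ∀ D {m m'} → word D m ≡ word D m' → m ≡ m'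
word-injective D {m} {m'} eq =
  +-cancelˡ-≡ D m m' (trans (≡.sym (length-word m)) (trans (cong length eq) (length-word m')))
  where
  length-word : ∀ m → length (word D m) ≡ D + m
  length-word m = trans (length-++ (replicate D b)) (cong₂ _+_ (length-replicate D) (length-replicate m))

YesInstance : ℕ → List (Fin 2) → Set
YesInstance n x = ∃ λ m → x ≡ word (dimension n) m × CommonMultiple (dimension n) m

NoInstance : ℕ → List (Fin 2) → Set
NoInstance n x = ∃ λ m → x ≡ word (dimension n) m × ∃ λ r₀ → CommonMultipleExcept (dimension n) r₀ m

promise : PromiseFamily 2
promise = record { L+ = YesInstance ; L- = NoInstance ; disj = disjoint }
  where
  disjoint : ∀ n x → YesInstance n x → NoInstance n x → ⊥
  disjoint n x (m , refl , common) (m' , x≡ , r₀ , r₀<D , r₀∤m' , _)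
    with refl ← word-injective (dimension n) x≡ = r₀∤m' (common r₀ r₀<D)

gapFamily : PolyNFAFamily 2
gapFamily = record
  { size  = λ n → stateCount (dimension n)
  ; M     = λ n → GapAutomaton.gapAutomaton (dimension n)
  ; poly  = stateCount 0 ∷ 1 ∷ []
  ; bound = λ n → ≤-trans (proj₁ (dimension-bounds n)) (≤-reflexive (linear n (stateCount 0)))
  }
  where
  linear : ∀ n c → n + c ≡ c + n * (1 + n * 0)
  linear = solve-∀

gap : ℕ → List (Fin 2) → ℤ
gap n x = ℤ.+ #acc (M n) x - ℤ.+ #rej (M n) x
  where open PolyNFAFamily gapFamily

promise∈1SP : In1SP promise
promise∈1SP = gap , (λ n x → YesInstance n x ⊎ NoInstance n x) , (gapFamily , λ _ _ _ → refl) ,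
  (λ _ _ inPromise → inPromise) , gap-yes , gap-no
  where
  open GapAutomaton
  gap-yes : ∀ n x → YesInstance n x → gap n x ≡ ℤ.+ 1
  gap-yes n x (m , refl , common) =
    cong₂ (λ p q → ℤ.+ p - ℤ.+ q) (#acc-word (dimension n) m)
          (trans (#rej-word (dimension n) m) (nonDivisorCount-common (dimension n) common))
  gap-no : ∀ n x → NoInstance n x → gap n x ≡ ℤ.+ 0
  gap-no n x (m , refl , r₀ , missing) =
    cong₂ (λ p q → ℤ.+ p - ℤ.+ q) (#acc-word (dimension n) m)
          (trans (#rej-word (dimension n) m) (nonDivisorCount-except (dimension n) missing))

polynomial-family-misclassifies : (F : PolyNFAFamily 2) → let open PolyNFAFamily F in
  ∃ λ n → (∀ x → YesInstance n x → #acc (M n) x > 0) → ∃ λ x → NoInstance n x × #acc (M n) x > 0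
polynomial-family-misclassifies F = n , fooled
  where
  open PolyNFAFamily F
  D₀ = proj₁ (polynomial<product-moduli poly)
  n = stateCount D₀
  D = dimension n
  n<stateCount : n < stateCount (suc D)
  n<stateCount = ≤-<-trans (m≤m+n n (stateCount 0)) (proj₂ (dimension-bounds n))
  size<product : size n < product (moduli D)
  size<product = begin-strict
    size n                             ≤⟨ bound n ⟩
    evalPoly poly n                    ≤⟨ evalPoly-mono poly (<⇒≤ n<stateCount) ⟩
    evalPoly poly (stateCount (suc D)) <⟨ proj₂ (polynomial<product-moduli poly) D (dimension-unbounded D₀) ⟩
    product (moduli D)                 ∎
    where open ≤-Reasoning
  fooled : (∀ x → YesInstance n x → #acc (M n) x > 0) → ∃ λ x → NoInstance n x × #acc (M n) x > 0
  fooled accepts-yes = near-word (small-automaton-accepts-near-multiple (M n) D size<product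
    (accepts-yes _ (size n * product (moduli D) , refl , commonMultiple-*product D (size n))))
    where
    near-word : (∃ λ m → (∃ λ r₀ → CommonMultipleExcept D r₀ m) × #acc (M n) (word D m) > 0) →
      ∃ λ x → NoInstance n x × #acc (M n) x > 0
    near-word (m , (r₀ , missing) , accepted) = word D m , (m , refl , r₀ , missing) , accepted

promise∉1N : ¬ In1N promise
promise∉1N (f , _ , (F , f≡#acc) , covers , yes>0 , no≡0) =
  let n , fooled = polynomial-family-misclassifies F
      f≡#acc-promise : ∀ {x} → (YesInstance n x ⊎ NoInstance n x) → f n x ≡ #acc (PolyNFAFamily.M F n) x
      f≡#acc-promise {x} inPromise = f≡#acc n x (covers n x inPromise)
      x , near , accepted = fooled (λ x yes → subst (_> 0) (f≡#acc-promise (inj₁ yes)) (yes>0 n x yes))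
  in <-irrefl refl (subst (_> 0) (trans (≡.sym (f≡#acc-promise (inj₂ near))) (no≡0 n x near)) accepted)

corollary4p5 : Σ ℕ λ k → Σ (PromiseFamily k) λ L → In1SP L × ¬ In1N L
corollary4p5 = 2 , promise , promise∈1SP , promise∉1N
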